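{- If $X$ and $Y$ are hereditarily self-full ceers, then $X\oplus Y$ is hereditarily self-full.
   Context: A ceer is a computably enumerable equivalence relation on $\omega$. A computable reduction of $R$ to $S$ is a total computable $f$ with $x\,R\,y\Leftrightarrow f(x)\,S\,f(y)$. A ceer $R$ is self-full if every computable reduction of $R$ to $R$ has range intersecting every $R$-class. The uniform join is $R\oplus S=\{(2x,2y):(x,y)\in R\}\cup\{(2x+1,2y+1):(x,y)\in S\}$. A ceer $X$ is hereditarily self-full if $X\oplus Y$ is self-full for every self-full ceer $Y$. -}

module Defs where

open import Data.Nat using (ℕ; zero; suc; _+_; _*_; _<_)
open import Data.Fin using (Fin)
open import Data.Vec using (Vec; []; _∷_; lookup)
open import Data.Product using (Σ; ∃; _×_; _,_)
open import Data.Sum using (_⊎_)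
open import Relation.Binary.PropositionalEquality using (_≡_)
open import Relation.Binary.Structures using (IsEquivalence)
open import Function.Bundles using (_⇔_)

data Code : ℕ → Set where
  zer  : ∀ {n} → Code n
  succ : Code 1
  proj : ∀ {n} → Fin n → Code n
  comp : ∀ {m n} → Code m → Vec (Code n) m → Code n
  prec : ∀ {n} → Code n → Code (suc (suc n)) → Code (suc n)
  mu   : ∀ {n} → Code (suc n) → Code n

mutual
  data Eval : ∀ {n} → Code n → Vec ℕ n → ℕ → Set where
    ev-zer  : ∀ {n} {xs : Vec ℕ n} → Eval zer xs 0
    ev-succ : ∀ {x} → Eval succ (x ∷ []) (suc x)
    ev-proj : ∀ {n} {i : Fin n} {xs} → Eval (proj i) xs (lookup xs i)
    ev-comp : ∀ {m n} {f : Code m} {gs : Vec (Code n) m} {xs ys v} →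
              EvalAll gs xs ys → Eval f ys v → Eval (comp f gs) xs v
    ev-prec-z : ∀ {n} {f : Code n} {g} {xs v} →
              Eval f xs v → Eval (prec f g) (0 ∷ xs) v
    ev-prec-s : ∀ {n} {f : Code n} {g} {k xs u v} →
              Eval (prec f g) (k ∷ xs) u → Eval g (k ∷ u ∷ xs) v →
              Eval (prec f g) (suc k ∷ xs) v
    ev-mu   : ∀ {n} {f : Code (suc n)} {xs k} →
              Eval f (k ∷ xs) 0 →
              (∀ i → i < k → ∃ λ v → Eval f (i ∷ xs) (suc v)) →
              Eval (mu f) xs k

  data EvalAll : ∀ {m n} → Vec (Code n) m → Vec ℕ n → Vec ℕ m → Set where
    []  : ∀ {n} {xs : Vec ℕ n} → EvalAll [] xs []
    _∷_ : ∀ {m n} {g : Code n} {gs : Vec (Code n) m} {xs y ys} →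
          Eval g xs y → EvalAll gs xs ys → EvalAll (g ∷ gs) xs (y ∷ ys)

Rel₂ : Set₁
Rel₂ = ℕ → ℕ → Set

Computable : (ℕ → ℕ) → Set
Computable f = Σ (Code 1) λ c → ∀ x → Eval c (x ∷ []) (f x)

CE : Rel₂ → Set
CE R = Σ (Code 2) λ c → ∀ x y → (R x y ⇔ ∃ λ v → Eval c (x ∷ y ∷ []) v)

Ceer : Rel₂ → Set
Ceer R = IsEquivalence R × CE R

Reduction : Rel₂ → Rel₂ → (ℕ → ℕ) → Set
Reduction R S f = Computable f × (∀ x y → (R x y ⇔ S (f x) (f y)))

SelfFull : Rel₂ → Set
SelfFull R = ∀ f → Reduction R R f → ∀ x → ∃ λ y → R x (f y)

_⊕_ : Rel₂ → Rel₂ → Rel₂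
(R ⊕ S) a b =
    (∃ λ x → ∃ λ y → a ≡ 2 * x × b ≡ 2 * y × R x y)
  ⊎ (∃ λ x → ∃ λ y → a ≡ 2 * x + 1 × b ≡ 2 * y + 1 × S x y)

-- hereditarily self-full: X ⊕ Y is self-full for every self-full ceer Y
-- (the theorem additionally assumes X is a ceer)
HereditarilySelfFull : Rel₂ → Set₁
HereditarilySelfFull X = ∀ (Y : Rel₂) → Ceer Y → SelfFull Y → SelfFull (X ⊕ Y)

-- The uniform join is associative up to computable bireducibility:
-- (X ⊕ Y) ⊕ Z and X ⊕ (Y ⊕ Z) reduce to each other by re-tagging even and odd
-- numbers, and self-fullness is invariant under bireducibility. Given a
-- self-full ceer Z, the join Y ⊕ Z is a self-full ceer because Y is
-- hereditarily self-full, so X ⊕ (Y ⊕ Z) is self-full because X is, and hence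
-- so is (X ⊕ Y) ⊕ Z.
module Submission where

open import Defs
open import Data.Nat using (ℕ; zero; suc; _+_; _*_)
open import Data.Nat.Properties using (*-suc; +-comm; +-identityʳ; <-cmp)
open import Data.Fin using (#_)
open import Data.Vec using (Vec; []; _∷_)
open import Data.Product using (Σ; ∃; _×_; _,_; proj₁; proj₂)
open import Data.Sum using (inj₁; inj₂)
open import Data.Empty using (⊥-elim)
open import Relation.Nullary using (¬_)
open import Relation.Binary.Definitions using (Symmetric; tri<; tri≈; tri>)
open import Relation.Binary.Structures using (IsEquivalence)
open import Relation.Binary.PropositionalEquality
open import Function using (_∘_; id; const)
open import Function.Bundles using (_⇔_; mk⇔; Equivalence)
open import Function.Construct.Composition using (_⇔-∘_)
open import Function.Construct.Symmetry using (⇔-sym)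

open Equivalence using (to; from)

mutual
  Eval-deterministic : ∀ {n} {c : Code n} {xs v w} → Eval c xs v → Eval c xs w → v ≡ w
  Eval-deterministic ev-zer ev-zer = refl
  Eval-deterministic ev-succ ev-succ = refl
  Eval-deterministic ev-proj ev-proj = refl
  Eval-deterministic (ev-comp es e) (ev-comp es′ e′) with EvalAll-deterministic es es′
  ... | refl = Eval-deterministic e e′
  Eval-deterministic (ev-prec-z e) (ev-prec-z e′) = Eval-deterministic e e′
  Eval-deterministic (ev-prec-s e g) (ev-prec-s e′ g′) with Eval-deterministic e e′
  ... | refl = Eval-deterministic g g′
  Eval-deterministic (ev-mu {k = k} e below) (ev-mu {k = k′} e′ below′) with <-cmp k k′
  ... | tri≈ _ refl _ = refl
  ... | tri< k<k′ _ _ with below′ k k<k′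
  ...   | _ , e-suc with Eval-deterministic e e-suc
  ...     | ()
  Eval-deterministic (ev-mu e below) (ev-mu e′ below′) | tri> _ _ k′<k with below _ k′<k
  ...   | _ , e-suc with Eval-deterministic e′ e-suc
  ...     | ()

  EvalAll-deterministic : ∀ {m n} {gs : Vec (Code n) m} {xs ys zs} →
    EvalAll gs xs ys → EvalAll gs xs zs → ys ≡ zs
  EvalAll-deterministic [] [] = refl
  EvalAll-deterministic (e ∷ es) (e′ ∷ es′) =
    cong₂ _∷_ (Eval-deterministic e e′) (EvalAll-deterministic es es′)

ap₁ : ∀ {n} → Code 1 → Code n → Code n
ap₁ c g = comp c (g ∷ [])

ap₂ : ∀ {n} → Code 2 → Code n → Code n → Code n
ap₂ c g h = comp c (g ∷ h ∷ [])

ap₃ : ∀ {n} → Code 3 → Code n → Code n → Code n → Code n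
ap₃ c g h i = comp c (g ∷ h ∷ i ∷ [])

isZero : ℕ → ℕ
isZero zero    = 1
isZero (suc _) = 0

parity : ℕ → ℕ
parity zero    = 0
parity (suc n) = isZero (parity n)

half : ℕ → ℕ
half zero    = 0
half (suc n) = half n + parity n

ifZero : ℕ → ℕ → ℕ → ℕ
ifZero zero    a b = a
ifZero (suc _) a b = b

⌜add⌝ : Code 2
⌜add⌝ = prec (proj (# 0)) (ap₁ succ (proj (# 1)))

⌜isZero⌝ ⌜parity⌝ ⌜half⌝ : Code 1
⌜isZero⌝ = prec (ap₁ succ zer) zer
⌜parity⌝ = prec zer (ap₁ ⌜isZero⌝ (proj (# 1)))
⌜half⌝   = prec zer (ap₂ ⌜add⌝ (proj (# 1)) (ap₁ ⌜parity⌝ (proj (# 0))))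

⌜ifZero⌝ : Code 3
⌜ifZero⌝ = prec (proj (# 0)) (proj (# 3))

⌜add⌝-eval : ∀ a b → Eval ⌜add⌝ (a ∷ b ∷ []) (a + b)
⌜add⌝-eval zero    b = ev-prec-z ev-proj
⌜add⌝-eval (suc a) b = ev-prec-s (⌜add⌝-eval a b) (ev-comp (ev-proj ∷ []) ev-succ)

⌜isZero⌝-eval : ∀ k → Eval ⌜isZero⌝ (k ∷ []) (isZero k)
⌜isZero⌝-eval zero    = ev-prec-z (ev-comp (ev-zer ∷ []) ev-succ)
⌜isZero⌝-eval (suc k) = ev-prec-s (⌜isZero⌝-eval k) ev-zer

⌜parity⌝-eval : ∀ k → Eval ⌜parity⌝ (k ∷ []) (parity k)
⌜parity⌝-eval zero    = ev-prec-z ev-zer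
⌜parity⌝-eval (suc k) =
  ev-prec-s (⌜parity⌝-eval k) (ev-comp (ev-proj ∷ []) (⌜isZero⌝-eval _))

⌜half⌝-eval : ∀ k → Eval ⌜half⌝ (k ∷ []) (half k)
⌜half⌝-eval zero    = ev-prec-z ev-zer
⌜half⌝-eval (suc k) = ev-prec-s (⌜half⌝-eval k)
  (ev-comp (ev-proj ∷ ev-comp (ev-proj ∷ []) (⌜parity⌝-eval k) ∷ []) (⌜add⌝-eval (half k) (parity k)))

⌜ifZero⌝-eval : ∀ k a b → Eval ⌜ifZero⌝ (k ∷ a ∷ b ∷ []) (ifZero k a b)
⌜ifZero⌝-eval zero    a b = ev-prec-z ev-proj
⌜ifZero⌝-eval (suc k) a b = ev-prec-s (⌜ifZero⌝-eval k a b) ev-proj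

inl inr : ℕ → ℕ
inl x = 2 * x
inr x = 2 * x + 1

inr≡suc-inl : ∀ x → inr x ≡ suc (inl x)
inr≡suc-inl x = +-comm (2 * x) 1

inl-suc : ∀ x → inl (suc x) ≡ suc (inr x)
inl-suc x = trans (*-suc 2 x) (cong suc (sym (inr≡suc-inl x)))

mutual
  parity-inl : ∀ x → parity (inl x) ≡ 0
  parity-inl zero    = refl
  parity-inl (suc x) = trans (cong parity (inl-suc x)) (cong isZero (parity-inr x))

  parity-inr : ∀ x → parity (inr x) ≡ 1
  parity-inr x = trans (cong parity (inr≡suc-inl x)) (cong isZero (parity-inl x))

mutual
  half-inl : ∀ x → half (inl x) ≡ x
  half-inl zero    = refl
  half-inl (suc x) = begin
    half (inl (suc x))             ≡⟨ cong half (inl-suc x) ⟩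
    half (inr x) + parity (inr x)  ≡⟨ cong₂ _+_ (half-inr x) (parity-inr x) ⟩
    x + 1                          ≡⟨ +-comm x 1 ⟩
    suc x                          ∎
    where open ≡-Reasoning

  half-inr : ∀ x → half (inr x) ≡ x
  half-inr x = begin
    half (inr x)                   ≡⟨ cong half (inr≡suc-inl x) ⟩
    half (inl x) + parity (inl x)  ≡⟨ cong₂ _+_ (half-inl x) (parity-inl x) ⟩
    x + 0                          ≡⟨ +-identityʳ x ⟩
    x                              ∎
    where open ≡-Reasoning

inl-injective : ∀ {x y} → inl x ≡ inl y → x ≡ y
inl-injective {x} {y} eq = trans (sym (half-inl x)) (trans (cong half eq) (half-inl y))

inr-injective : ∀ {x y} → inr x ≡ inr y → x ≡ y
inr-injective {x} {y} eq = trans (sym (half-inr x)) (trans (cong half eq) (half-inr y))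

inl≢inr : ∀ x y → inl x ≢ inr y
inl≢inr x y eq with trans (sym (parity-inl x)) (trans (cong parity eq) (parity-inr y))
... | ()

data Parity : ℕ → Set where
  even : ∀ x → Parity (inl x)
  odd  : ∀ x → Parity (inr x)

parityView : ∀ n → Parity n
parityView zero = even 0
parityView (suc n) with parityView n
... | even x = subst Parity (inr≡suc-inl x) (odd x)
... | odd x  = subst Parity (inl-suc x) (even (suc x))

copair : (ℕ → ℕ) → (ℕ → ℕ) → ℕ → ℕ
copair f g n = ifZero (parity n) (f (half n)) (g (half n))

copair-inl : ∀ f g x → copair f g (inl x) ≡ f x
copair-inl f g x = cong₂ (λ p h → ifZero p (f h) (g h)) (parity-inl x) (half-inl x)

copair-inr : ∀ f g x → copair f g (inr x) ≡ g x
copair-inr f g x = cong₂ (λ p h → ifZero p (f h) (g h)) (parity-inr x) (half-inr x)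

Computable-∘ : ∀ {f g} → Computable f → Computable g → Computable (f ∘ g)
Computable-∘ {f} {g} (cf , ef) (cg , eg) = ap₁ cf cg , λ x → ev-comp (eg x ∷ []) (ef (g x))

-- 2 * x unfolds to x + (x + 0).
Computable-inl : Computable inl
Computable-inl = ap₂ ⌜add⌝ (proj (# 0)) (ap₂ ⌜add⌝ (proj (# 0)) zer) , λ x →
  ev-comp (ev-proj ∷ ev-comp (ev-proj ∷ ev-zer ∷ []) (⌜add⌝-eval x 0) ∷ []) (⌜add⌝-eval x (x + 0))

Computable-inr : Computable inr
Computable-inr = ap₂ ⌜add⌝ (proj₁ Computable-inl) (ap₁ succ zer) , λ x →
  ev-comp (proj₂ Computable-inl x ∷ ev-comp (ev-zer ∷ []) ev-succ ∷ []) (⌜add⌝-eval (inl x) 1)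

Computable-copair : ∀ {f g} → Computable f → Computable g → Computable (copair f g)
Computable-copair {f} {g} (cf , ef) (cg , eg) =
  ap₃ ⌜ifZero⌝ (ap₁ ⌜parity⌝ (proj (# 0))) (ap₁ cf ⌜half⌝′) (ap₁ cg ⌜half⌝′) , λ n →
    ev-comp (ev-comp (ev-proj ∷ []) (⌜parity⌝-eval n)
           ∷ ev-comp (half-eval n ∷ []) (ef (half n))
           ∷ ev-comp (half-eval n ∷ []) (eg (half n)) ∷ [])
      (⌜ifZero⌝-eval _ _ _)
  where
  ⌜half⌝′ : Code 1
  ⌜half⌝′ = ap₁ ⌜half⌝ (proj (# 0))
  half-eval : ∀ n → Eval ⌜half⌝′ (n ∷ []) (half n)
  half-eval n = ev-comp (ev-proj ∷ []) (⌜half⌝-eval n)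

Computable₂ : (ℕ → ℕ → ℕ) → Set
Computable₂ g = Σ (Code 2) λ c → ∀ a b → Eval c (a ∷ b ∷ []) (g a b)

parityMismatch : ℕ → ℕ → ℕ
parityMismatch a b = ifZero (parity a) (parity b) (isZero (parity b))

Computable₂-parityMismatch : Computable₂ parityMismatch
Computable₂-parityMismatch =
  ap₃ ⌜ifZero⌝ (ap₁ ⌜parity⌝ (proj (# 0))) (ap₁ ⌜parity⌝ (proj (# 1)))
               (ap₁ ⌜isZero⌝ (ap₁ ⌜parity⌝ (proj (# 1)))) , λ a b →
    ev-comp (ev-comp (ev-proj ∷ []) (⌜parity⌝-eval a)
           ∷ ev-comp (ev-proj ∷ []) (⌜parity⌝-eval b)
           ∷ ev-comp (ev-comp (ev-proj ∷ []) (⌜parity⌝-eval b) ∷ []) (⌜isZero⌝-eval _) ∷ [])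
      (⌜ifZero⌝-eval _ _ _)

CE-resp : ∀ {P Q : Rel₂} → (∀ a b → P a b ⇔ Q a b) → CE P → CE Q
CE-resp P⇔Q (c , halts) = c , λ a b → halts a b ⇔-∘ ⇔-sym (P⇔Q a b)

CE-× : ∀ {P Q : Rel₂} → CE P → CE Q → CE (λ a b → P a b × Q a b)
CE-× (cP , haltsP) (cQ , haltsQ) = comp zer (cP ∷ cQ ∷ []) , λ a b → mk⇔
  (λ (p , q) → 0 , ev-comp (proj₂ (to (haltsP a b) p) ∷ proj₂ (to (haltsQ a b) q) ∷ []) ev-zer)
  (λ { (_ , ev-comp (eP ∷ eQ ∷ []) _) → from (haltsP a b) (_ , eP) , from (haltsQ a b) (_ , eQ) })

CE-preimage : ∀ {f} {R : Rel₂} → Computable f → CE R → CE (λ a b → R (f a) (f b))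
CE-preimage {f} {R} (cf , ef) (cR , halts) =
  comp cR (ap₁ cf (proj (# 0)) ∷ ap₁ cf (proj (# 1)) ∷ []) , λ a b → mk⇔
    (λ r → let (v , e) = to (halts (f a) (f b)) r in
      v , ev-comp (ev-comp (ev-proj ∷ []) (ef a) ∷ ev-comp (ev-proj ∷ []) (ef b) ∷ []) e)
    (reflect a b)
  where
  reflect : ∀ a b → (∃ λ v → Eval (comp cR (ap₁ cf (proj (# 0)) ∷ ap₁ cf (proj (# 1)) ∷ []))
                                    (a ∷ b ∷ []) v) → R (f a) (f b)
  reflect a b (v , ev-comp (ev-comp (ev-proj ∷ []) ea ∷ ev-comp (ev-proj ∷ []) eb ∷ []) e)
    with Eval-deterministic ea (ef a) | Eval-deterministic eb (ef b)
  ... | refl | refl = from (halts (f a) (f b)) (v , e)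

CE-zeroes : ∀ {g} → Computable₂ g → CE (λ a b → g a b ≡ 0)
CE-zeroes {g} (cg , eg) = mu (comp cg (proj (# 1) ∷ proj (# 2) ∷ [])) , λ a b → mk⇔
  (λ g≡0 → 0 , ev-mu (ev-comp (ev-proj ∷ ev-proj ∷ []) (subst (Eval cg (a ∷ b ∷ [])) g≡0 (eg a b)))
                     (λ _ ()))
  (λ { (_ , ev-mu (ev-comp (ev-proj ∷ ev-proj ∷ []) e) _) → Eval-deterministic (eg a b) e })

module _ {R S : Rel₂} where

  ⊕-inl⇔ : ∀ x y → (R ⊕ S) (inl x) (inl y) ⇔ R x y
  ⊕-inl⇔ x y = mk⇔ reflect (λ r → inj₁ (x , y , refl , refl , r))
    where
    reflect : (R ⊕ S) (inl x) (inl y) → R x y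
    reflect (inj₁ (x′ , y′ , eqx , eqy , r)) =
      subst₂ R (sym (inl-injective {x} {x′} eqx)) (sym (inl-injective {y} {y′} eqy)) r
    reflect (inj₂ (x′ , _ , eqx , _ , _)) = ⊥-elim (inl≢inr x x′ eqx)

  ⊕-inr⇔ : ∀ x y → (R ⊕ S) (inr x) (inr y) ⇔ S x y
  ⊕-inr⇔ x y = mk⇔ reflect (λ s → inj₂ (x , y , refl , refl , s))
    where
    reflect : (R ⊕ S) (inr x) (inr y) → S x y
    reflect (inj₁ (x′ , _ , eqx , _ , _)) = ⊥-elim (inl≢inr x′ x (sym eqx))
    reflect (inj₂ (x′ , y′ , eqx , eqy , s)) =
      subst₂ S (sym (inr-injective {x} {x′} eqx)) (sym (inr-injective {y} {y′} eqy)) s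

  ⊕-inl-inr : ∀ x y → ¬ (R ⊕ S) (inl x) (inr y)
  ⊕-inl-inr x y (inj₁ (_ , y′ , _ , eqy , _)) = inl≢inr y′ y (sym eqy)
  ⊕-inl-inr x y (inj₂ (x′ , _ , eqx , _ , _)) = inl≢inr x x′ eqx

  ⊕-inr-inl : ∀ x y → ¬ (R ⊕ S) (inr x) (inl y)
  ⊕-inr-inl x y (inj₁ (x′ , _ , eqx , _ , _)) = inl≢inr x′ x (sym eqx)
  ⊕-inr-inl x y (inj₂ (_ , y′ , _ , eqy , _)) = inl≢inr y y′ eqy

  ⊕-sym : Symmetric R → Symmetric S → Symmetric (R ⊕ S)
  ⊕-sym R-sym _ (inj₁ (x , y , eqx , eqy , r)) = inj₁ (y , x , eqy , eqx , R-sym r)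
  ⊕-sym _ S-sym (inj₂ (x , y , eqx , eqy , s)) = inj₂ (y , x , eqy , eqx , S-sym s)

  ⊕-isEquivalence : IsEquivalence R → IsEquivalence S → IsEquivalence (R ⊕ S)
  ⊕-isEquivalence R-eq S-eq = record
    { refl  = λ {n} → ⊕-refl (parityView n)
    ; sym   = ⊕-sym R.sym S.sym
    ; trans = ⊕-trans
    }
    where
    module R = IsEquivalence R-eq
    module S = IsEquivalence S-eq
    ⊕-refl : ∀ {n} → Parity n → (R ⊕ S) n n
    ⊕-refl (even x) = from (⊕-inl⇔ x x) R.refl
    ⊕-refl (odd x)  = from (⊕-inr⇔ x x) S.refl
    ⊕-trans : ∀ {n m k} → (R ⊕ S) n m → (R ⊕ S) m k → (R ⊕ S) n k
    ⊕-trans (inj₁ (x , y , refl , refl , r)) (inj₁ (y′ , z , eq , refl , r′)) =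
      from (⊕-inl⇔ x z) (R.trans r (subst (λ t → R t z) (sym (inl-injective {y} {y′} eq)) r′))
    ⊕-trans (inj₁ (_ , y , refl , refl , _)) (inj₂ (y′ , _ , eq , _ , _)) = ⊥-elim (inl≢inr y y′ eq)
    ⊕-trans (inj₂ (_ , y , refl , refl , _)) (inj₁ (y′ , _ , eq , _ , _)) = ⊥-elim (inl≢inr y′ y (sym eq))
    ⊕-trans (inj₂ (x , y , refl , refl , s)) (inj₂ (y′ , z , eq , refl , s′)) =
      from (⊕-inr⇔ x z) (S.trans s (subst (λ t → S t z) (sym (inr-injective {y} {y′} eq)) s′))

evenPart oddPart : ℕ → ℕ
evenPart = copair id (const 0)
oddPart  = copair (const 0) id

module _ {R S : Rel₂} where

  -- Feeding 0 to the component that does not match the parity lets a single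
  -- program run both halting tests unconditionally.
  ⊕⇔halves : R 0 0 → S 0 0 → ∀ a b → (R ⊕ S) a b ⇔
    (R (evenPart a) (evenPart b) × S (oddPart a) (oddPart b) × parityMismatch a b ≡ 0)
  ⊕⇔halves r₀ s₀ a b with parityView a | parityView b
  ... | even x | even y
    rewrite copair-inl id (const 0) x | copair-inl id (const 0) y
          | copair-inl (const 0) id x | copair-inl (const 0) id y
          | parity-inl x | parity-inl y
    = mk⇔ (λ h → to (⊕-inl⇔ x y) h , s₀ , refl) (from (⊕-inl⇔ x y) ∘ proj₁)
  ... | even x | odd y
    rewrite parity-inl x | parity-inr y
    = mk⇔ (⊥-elim ∘ ⊕-inl-inr x y) (λ ())
  ... | odd x | even y
    rewrite parity-inr x | parity-inl y
    = mk⇔ (⊥-elim ∘ ⊕-inr-inl x y) (λ ())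
  ... | odd x | odd y
    rewrite copair-inr id (const 0) x | copair-inr id (const 0) y
          | copair-inr (const 0) id x | copair-inr (const 0) id y
          | parity-inr x | parity-inr y
    = mk⇔ (λ h → r₀ , to (⊕-inr⇔ x y) h , refl) (from (⊕-inr⇔ x y) ∘ proj₁ ∘ proj₂)

CE-⊕ : ∀ {R S : Rel₂} → R 0 0 → S 0 0 → CE R → CE S → CE (R ⊕ S)
CE-⊕ r₀ s₀ R-ce S-ce = CE-resp (λ a b → ⇔-sym (⊕⇔halves r₀ s₀ a b))
  (CE-× (CE-preimage evenPart-computable R-ce)
        (CE-× (CE-preimage oddPart-computable S-ce) (CE-zeroes Computable₂-parityMismatch)))
  where
  Computable-id : Computable id
  Computable-id = proj (# 0) , λ _ → ev-proj
  Computable-0 : Computable (const 0)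
  Computable-0 = zer , λ _ → ev-zer
  evenPart-computable : Computable evenPart
  evenPart-computable = Computable-copair Computable-id Computable-0
  oddPart-computable : Computable oddPart
  oddPart-computable = Computable-copair Computable-0 Computable-id

Ceer-⊕ : ∀ {R S : Rel₂} → Ceer R → Ceer S → Ceer (R ⊕ S)
Ceer-⊕ (R-eq , R-ce) (S-eq , S-ce) =
  ⊕-isEquivalence R-eq S-eq , CE-⊕ (IsEquivalence.refl R-eq) (IsEquivalence.refl S-eq) R-ce S-ce

Reduction-∘ : ∀ {R S T : Rel₂} {f g} → Reduction S T g → Reduction R S f → Reduction R T (g ∘ f)
Reduction-∘ {f = f} (g-comp , g-red) (f-comp , f-red) =
  Computable-∘ g-comp f-comp , λ x y → g-red (f x) (f y) ⇔-∘ f-red x y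

inl-reduction : ∀ {R S : Rel₂} → Reduction R (R ⊕ S) inl
inl-reduction = Computable-inl , λ x y → ⇔-sym (⊕-inl⇔ x y)

inr-reduction : ∀ {R S : Rel₂} → Reduction S (R ⊕ S) inr
inr-reduction = Computable-inr , λ x y → ⇔-sym (⊕-inr⇔ x y)

copair-reduction : ∀ {R S T : Rel₂} {f g} → Symmetric T →
  Reduction R T f → Reduction S T g → (∀ x y → ¬ T (f x) (g y)) →
  Reduction (R ⊕ S) T (copair f g)
copair-reduction {R} {S} {T} {f} {g} T-sym (f-comp , f-red) (g-comp , g-red) separated =
  Computable-copair f-comp g-comp , λ a b → reduces (parityView a) (parityView b)
  where
  reduces : ∀ {a b} → Parity a → Parity b → (R ⊕ S) a b ⇔ T (copair f g a) (copair f g b)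
  reduces (even x) (even y) rewrite copair-inl f g x | copair-inl f g y = f-red x y ⇔-∘ ⊕-inl⇔ x y
  reduces (odd x)  (odd y)  rewrite copair-inr f g x | copair-inr f g y = g-red x y ⇔-∘ ⊕-inr⇔ x y
  reduces (even x) (odd y)  rewrite copair-inl f g x | copair-inr f g y =
    mk⇔ (⊥-elim ∘ ⊕-inl-inr x y) (⊥-elim ∘ separated x y)
  reduces (odd x)  (even y) rewrite copair-inr f g x | copair-inl f g y =
    mk⇔ (⊥-elim ∘ ⊕-inr-inl x y) (⊥-elim ∘ separated y x ∘ T-sym)

SelfFull-resp-bireducible : ∀ {A B : Rel₂} {π σ} →
  Reduction A B π → Reduction B A σ → SelfFull B → SelfFull A
SelfFull-resp-bireducible {A} {B} {π} {σ} π-red σ-red B-selfFull f f-red a =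
  let (y , a~fσy) = B-selfFull (π ∘ f ∘ σ) conjugate (π a)
  in σ y , from (proj₂ π-red a (f (σ y))) a~fσy
  where
  conjugate : Reduction B B (π ∘ f ∘ σ)
  conjugate = Reduction-∘ {B} {A} {B} {f ∘ σ} π-red (Reduction-∘ {B} {A} {A} {σ} f-red σ-red)

assocʳ assocˡ : ℕ → ℕ
assocʳ = copair (copair inl (inr ∘ inl)) (inr ∘ inr)
assocˡ = copair (inl ∘ inl) (copair (inl ∘ inr) inr)

module _ {X Y Z : Rel₂} (X-sym : Symmetric X) (Y-sym : Symmetric Y) (Z-sym : Symmetric Z) where

  private
    A B : Rel₂
    A = (X ⊕ Y) ⊕ Z
    B = X ⊕ (Y ⊕ Z)
    A-sym : Symmetric A
    A-sym = ⊕-sym (⊕-sym X-sym Y-sym) Z-sym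
    B-sym : Symmetric B
    B-sym = ⊕-sym X-sym (⊕-sym Y-sym Z-sym)

  ⊕-assocʳ-reduction : Reduction ((X ⊕ Y) ⊕ Z) (X ⊕ (Y ⊕ Z)) assocʳ
  ⊕-assocʳ-reduction =
    copair-reduction {X ⊕ Y} {Z} {B} B-sym
      (copair-reduction {X} {Y} {B} B-sym inl-reduction
        (Reduction-∘ {Y} {Y ⊕ Z} {B} (inr-reduction {X}) inl-reduction)
        (λ x y → ⊕-inl-inr x (inl y)))
      (Reduction-∘ {Z} {Y ⊕ Z} {B} (inr-reduction {X}) inr-reduction)
      separated
    where
    separated : ∀ a z → ¬ B (copair inl (inr ∘ inl) a) (inr (inr z))
    separated a z with parityView a
    ... | even x rewrite copair-inl inl (inr ∘ inl) x = ⊕-inl-inr x (inr z)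
    ... | odd y  rewrite copair-inr inl (inr ∘ inl) y = ⊕-inl-inr y z ∘ to (⊕-inr⇔ (inl y) (inr z))

  ⊕-assocˡ-reduction : Reduction (X ⊕ (Y ⊕ Z)) ((X ⊕ Y) ⊕ Z) assocˡ
  ⊕-assocˡ-reduction =
    copair-reduction {X} {Y ⊕ Z} {A} A-sym
      (Reduction-∘ {X} {X ⊕ Y} {A} inl-reduction inl-reduction)
      (copair-reduction {Y} {Z} {A} A-sym
        (Reduction-∘ {Y} {X ⊕ Y} {A} inl-reduction inr-reduction)
        inr-reduction
        (λ y z → ⊕-inl-inr (inr y) z))
      separated
    where
    separated : ∀ x b → ¬ A (inl (inl x)) (copair (inl ∘ inr) inr b)
    separated x b with parityView b
    ... | even y rewrite copair-inl (inl ∘ inr) inr y = ⊕-inl-inr x y ∘ to (⊕-inl⇔ (inl x) (inr y))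
    ... | odd z  rewrite copair-inr (inl ∘ inr) inr z = ⊕-inl-inr (inl x) z

mainTheorem8 : (X Y : Rel₂) → Ceer X → Ceer Y →
    HereditarilySelfFull X → HereditarilySelfFull Y →
    HereditarilySelfFull (X ⊕ Y)
mainTheorem8 X Y (X-eq , _) Y-ceer X-hsf Y-hsf Z Z-ceer@(Z-eq , _) Z-selfFull =
  SelfFull-resp-bireducible
    (⊕-assocʳ-reduction X.sym Y.sym Z.sym)
    (⊕-assocˡ-reduction X.sym Y.sym Z.sym)
    (X-hsf (Y ⊕ Z) (Ceer-⊕ Y-ceer Z-ceer) (Y-hsf Z Z-ceer Z-selfFull))
  where
  module X = IsEquivalence X-eq
  module Y = IsEquivalence (proj₁ Y-ceer)
  module Z = IsEquivalence Z-eq
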